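{- For every integer $N \ge 0$, the equality negation task for two processes is not solvable in the $N$-layer message-passing model; that is, there is no morphism of simplicial models $\delta : \mathcal{I}[\mathcal{MP}_N] \to \mathcal{O}$ such that $\pi \circ \delta = \pi$, where $\pi : \mathcal{I}[\mathcal{MP}_N]\to\mathcal{I}$ and $\pi:\mathcal{O}\to\mathcal{I}$ are the projections described in the context.
   Context: Simplicial models. Fix a finite set $\mathrm{Ag}$ of agents. A simplicial complex is a family $C$ of non-empty finite subsets (simplices) of a vertex set closed under taking non-empty subsets; facets (also called worlds) are the maximal simplices. A chromatic simplicial complex comes with a coloring $\chi$ from vertices to $\mathrm{Ag}$ such that the vertices of each simplex have distinct colors. A simplicial model $\mathcal{M}=\langle C,\chi,\ell\rangle$ is a pure chromatic simplicial complex of dimension $|\mathrm{Ag}|-1$ together with a labeling $\ell$ assigning to each vertex $v$ a set of atomic propositions concerning agent $\chi(v)$. For a facet $X$, $\ell(X)=\bigcup_{v\in X}\ell(v)$. Formulas: $\varphi ::= p \mid \neg\varphi \mid \varphi\wedge\varphi \mid K_a\varphi$; semantics: $\mathcal{M},X\models p$ iff $p\in\ell(X)$; negation and conjunction as usual; $\mathcal{M},X\models K_a\varphi$ iff $\mathcal{M},Y\models\varphi$ for every facet $Y$ with $a\in\chi(X\cap Y)$. A morphism of simplicial models is a map on vertices sending simplices to simplices and preserving $\chi$ and $\ell$. Action models and product update. An action model $\mathcal{A}=\langle T,\sim,\mathsf{pre}\rangle$ consists of a set $T$ of actions, an equivalence relation $\sim_a$ on $T$ for each agent $a$, and a precondition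 formula $\mathsf{pre}(t)$ for each $t\in T$. The product update $\mathcal{M}[\mathcal{A}]$ has as vertices the pairs $(v,E)$ with $v$ a vertex of $C$ and $E$ an equivalence class of $\sim_{\chi(v)}$ such that some facet $X\ni v$ and some $t\in E$ satisfy $\mathcal{M},X\models\mathsf{pre}(t)$; its facets are the sets $\{(v,[t]_{\chi(v)}) : v\in X\}$ for facets $X$ of $C$ and actions $t$ with $\mathcal{M},X\models\mathsf{pre}(t)$ (simplices are their non-empty subsets); color and labeling of $(v,E)$ are those of $v$. The projection $\pi:\mathcal{M}[\mathcal{A}]\to\mathcal{M}$ is $(v,E)\mapsto v$. Equality negation. $\mathrm{Ag}=\{B,W\}$; atomic propositions $\mathrm{in}_p^i$ ($p\in\mathrm{Ag}$, $i\in\{0,1,2\}$), meaning "process $p$ has input $i$". The input model $\mathcal{I}$ has vertices $(p,i)\in\mathrm{Ag}\times\{0,1,2\}$, facets all $\{(B,i),(W,j)\}$ for $i,j\in\{0,1,2\}$, coloring $\chi(p,i)=p$, labeling $\ell(p,i)=\{\mathrm{in}_p^i\}$. The output model $\mathcal{O}$ (the product update of $\mathcal{I}$ by the task action model with actions $(d_B,d_W)\in\{0,1\}^2$, $(d_B,d_W)\sim_p(d_B',d_W')$ iff $d_p=d_p'$, and $\mathsf{pre}(d_B,d_W)$ true exactly on input facets with different inputs if $d_B=d_W$ and with equal inputs otherwise) has vertices $(p,i,d)$ with $p\in\mathrm{Ag}$, $i\in\{0,1,2\}$, $d\in\{0,1\}$, facets $\{(B,i,d_B),(W,j,d_W)\}$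 where $i=j \iff d_B\neq d_W$, coloring $p$, labeling $\{\mathrm{in}_p^i\}$, and projection $\pi(p,i,d)=(p,i)$. $N$-layer message-passing action model $\mathcal{MP}_N=\langle T,\sim,\mathsf{pre}\rangle$ over $\mathcal{I}$: $L_N$ is the set of words of length $N$ over $\{\bot,B,W\}$; $T=L_N\times\mathcal{F}(\mathcal{I})$ where $\mathcal{F}(\mathcal{I})$ is the set of facets of $\mathcal{I}$; $\mathsf{pre}(\alpha,X)=\bigwedge_{a\in\mathrm{Ag}}\mathrm{in}_a^{X_a}$ where $X_a$ is $a$'s input in $X$. For $N=0$: $(\varepsilon,X)\sim_a(\varepsilon,Y)$ iff $X_a=Y_a$. For $\alpha,\beta\in L_N$, $p,q\in\{\bot,B,W\}$: $(\alpha p,X)\sim_B(\beta q,Y)$ iff either $p=q=W$ and $(\alpha,X)\sim_B(\beta,Y)$, or $p,q\in\{\bot,B\}$, $X=Y$ and $\alpha=\beta$; $\sim_W$ is defined symmetrically with the roles of $B$ and $W$ exchanged. -}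

module Defs where

open import Data.Nat using (ℕ; zero; suc)
open import Data.Fin using (Fin)
open import Data.Product using (Σ; ∃; _×_; _,_)
open import Data.Sum using (_⊎_)
open import Data.List using (List; []; _∷_; map)
open import Data.List.Relation.Unary.All using (All)
open import Relation.Binary.PropositionalEquality using (_≡_; _≢_)
open import Relation.Nullary using (¬_)
open import Data.Empty using (⊥)

data Ag : Set where
  B W : Ag

other : Ag → Ag
other B = W
other W = B

Input : Set
Input = Fin 3

data Atom : Set where
  inp : Ag → Input → Atom

-- Input model 𝓘
-- vertices (p , i); facets {(B,i),(W,j)} for all i j, represented by (i , j)

IVertex : Set
IVertex = Ag × Input

record IFacet : Set where
  constructor ⟨_,_⟩
  field
    inB : Input
    inW : Input

_at_ : IFacet → Ag → Input
X at B = IFacet.inB X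
X at W = IFacet.inW X

_∈I_ : IVertex → IFacet → Set
(p , i) ∈I X = X at p ≡ i

-- semantics of atoms at a facet of 𝓘:  𝓘, X ⊨ in_a^i  iff  in_a^i ∈ ℓ(X)
--   and ℓ(X) = { in_B^{X_B} , in_W^{X_W} }
_⊨I_ : IFacet → Atom → Set
X ⊨I inp a i = X at a ≡ i

data Letter : Set where
  ⊥ₗ : Letter
  ag : Ag → Letter

data Word : ℕ → Set where
  ε   : Word zero
  _▸_ : ∀ {n} → Word n → Letter → Word (suc n)

Act : ℕ → Set
Act N = Word N × IFacet

Quiet : Ag → Letter → Set
Quiet a p = p ≡ ⊥ₗ ⊎ p ≡ ag a

Indist : (a : Ag) {N : ℕ} → Act N → Act N → Set
Indist a {zero} (ε , X) (ε , Y) = X at a ≡ Y at a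
Indist a {suc n} (α ▸ p , X) (β ▸ q , Y) =
    (p ≡ ag (other a) × q ≡ ag (other a) × Indist a (α , X) (β , Y))
  ⊎ (Quiet a p × Quiet a q × X ≡ Y × α ≡ β)

Pre : ∀ {N} → Act N → IFacet → Set
Pre (α , X) Z = (a : Ag) → Z ⊨I inp a (X at a)

-- Product update 𝓘[𝓜𝓟_N]
-- A vertex (v , E) with E an equivalence class of ∼_{χ(v)} is represented
-- by v together with a representative action of E; two representations
-- denote the same vertex iff they are related by _≈P_ below.

record PVertex (N : ℕ) : Set where
  field
    colour : Ag
    input  : Input
    act    : Act N
    -- existence condition: some facet Z ∋ v and some t' ∈ E with Z ⊨ pre(t')
    live   : ∃ λ (t' : Act N) → Indist colour t' act ×
               ∃ λ (Z : IFacet) → (colour , input) ∈I Z × Pre t' Z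
open PVertex public

_≈P_ : ∀ {N} → PVertex N → PVertex N → Set
v ≈P w = Σ (colour v ≡ colour w) λ _ →
           input v ≡ input w × Indist (colour v) (act v) (act w)

InPFacet : ∀ {N} → PVertex N → IFacet → Act N → Set
InPFacet v Z t = (colour v , input v) ∈I Z × Indist (colour v) (act v) t

-- simplices of 𝓘[𝓜𝓟_N]: non-empty subsets of facets {(u,[t]) : u ∈ Z}
-- with 𝓘, Z ⊨ pre(t)
IsPSimplex : ∀ {N} → List (PVertex N) → Set
IsPSimplex {N} [] = ⊥
IsPSimplex {N} (v ∷ vs) =
  ∃ λ (Z : IFacet) → ∃ λ (t : Act N) → Pre t Z × All (λ u → InPFacet u Z t) (v ∷ vs)

colourP : ∀ {N} → PVertex N → Ag
colourP = colour

labelP : ∀ {N} → PVertex N → Atom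
labelP v = inp (colour v) (input v)

πP : ∀ {N} → PVertex N → IVertex
πP v = (colour v , input v)

Dec01 : Set
Dec01 = Fin 2

OVertex : Set
OVertex = Ag × Input × Dec01

record OFacet : Set where
  field
    iB : Input
    dB : Dec01
    iW : Input
    dW : Dec01
    valid : (iB ≡ iW → dB ≢ dW) × (dB ≢ dW → iB ≡ iW)

_∈O_ : OVertex → OFacet → Set
(p , i , d) ∈O F =
    (p ≡ B × i ≡ OFacet.iB F × d ≡ OFacet.dB F)
  ⊎ (p ≡ W × i ≡ OFacet.iW F × d ≡ OFacet.dW F)

IsOSimplex : List OVertex → Set
IsOSimplex [] = ⊥
IsOSimplex (v ∷ vs) = ∃ λ (F : OFacet) → All (λ u → u ∈O F) (v ∷ vs)

colourO : OVertex → Ag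
colourO (p , i , d) = p

labelO : OVertex → Atom
labelO (p , i , d) = inp p i

πO : OVertex → IVertex
πO (p , i , d) = (p , i)

record IsMorphism {N : ℕ} (δ : PVertex N → OVertex) : Set where
  field
    wellDefined : ∀ v w → v ≈P w → δ v ≡ δ w
    simplices   : ∀ σ → IsPSimplex σ → IsOSimplex (map δ σ)
    colours     : ∀ v → colourO (δ v) ≡ colourP v
    labels      : ∀ v → labelO (δ v) ≡ labelP v

-- A solution with N + 1 rounds yields one with N rounds: in the new last round B
-- decides as if it had heard from W, and W as if it had heard from B.  The facets
-- of the actions α ▸ W, α ▸ ⊥ and α ▸ B (same inputs) form a path in which W's
-- vertex is shared by the first two and B's vertex by the last two, so validity
-- propagates from the ends of the path to the new pair of decisions.  Without
-- communication each decision depends only on the process' own input, and the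
-- cycle of inputs (0,0), (0,2), (1,2), (1,0) forces B and W to agree on (0,0).
module Submission where

open import Defs
open import Data.Nat using (ℕ; zero; suc)
open import Data.Fin using (Fin)
open import Data.Fin.Patterns using (0F; 1F; 2F)
open import Data.Fin.Properties using (_≟_)
open import Data.Product using (Σ; _×_; _,_; proj₁; proj₂)
open import Data.Sum using (_⊎_; inj₁; inj₂; [_,_])
open import Data.List using (_∷_; [])
open import Data.List.Relation.Unary.All using (_∷_; [])
open import Relation.Binary.PropositionalEquality
  using (_≡_; _≢_; refl; sym; trans; cong; module ≡-Reasoning)
open import Relation.Nullary using (¬_; yes; no; contradiction)
open import Relation.Nullary.Decidable using (decidable-stable)

Valid : {A : Set} → A → A → Dec01 → Dec01 → Set
Valid i j a b = (i ≡ j → a ≢ b) × (a ≢ b → i ≡ j)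

≢-≢⇒≡ : {a b c : Fin 2} → a ≢ b → c ≢ b → a ≡ c
≢-≢⇒≡ {0F} {0F}      a≢b _   = contradiction refl a≢b
≢-≢⇒≡ {0F} {1F} {0F} _   _   = refl
≢-≢⇒≡ {0F} {1F} {1F} _   c≢b = contradiction refl c≢b
≢-≢⇒≡ {1F} {0F} {0F} _   c≢b = contradiction refl c≢b
≢-≢⇒≡ {1F} {0F} {1F} _   _   = refl
≢-≢⇒≡ {1F} {1F}      a≢b _   = contradiction refl a≢b

≢-split : {a b d f : Fin 2} → a ≢ f → a ≢ b ⊎ d ≢ b ⊎ d ≢ f
≢-split {a} {b} {d} {f} a≢f with a ≟ b | d ≟ b | d ≟ f
... | no a≢b   | _        | _        = inj₁ a≢b
... | yes _    | no d≢b   | _        = inj₂ (inj₁ d≢b)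
... | yes _    | yes _    | no d≢f   = inj₂ (inj₂ d≢f)
... | yes refl | yes refl | yes refl = contradiction refl a≢f

valid-zigzag : ∀ {A : Set} {i j : A} {a b b′ d d′ f : Dec01} →
  Valid i j a b → b ≡ b′ → Valid i j d b′ → d ≡ d′ → Valid i j d′ f → Valid i j a f
valid-zigzag (r₁ , r₂) refl (s₁ , s₂) refl (t₁ , t₂) =
  (λ i≡j a≡f → t₁ i≡j (trans (sym (≢-≢⇒≡ (r₁ i≡j) (s₁ i≡j))) a≡f)) ,
  (λ a≢f → [ r₂ , [ s₂ , t₂ ] ] (≢-split a≢f))

valid-distinct : ∀ {A : Set} {i j : A} {a b : Dec01} → i ≢ j → Valid i j a b → a ≡ b
valid-distinct i≢j (_ , r₂) = decidable-stable (_ ≟ _) (λ a≢b → i≢j (r₂ a≢b))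

quiet-or-other : ∀ a p → Quiet a p ⊎ p ≡ ag (other a)
quiet-or-other a ⊥ₗ     = inj₁ (inj₁ refl)
quiet-or-other B (ag B) = inj₁ (inj₂ refl)
quiet-or-other B (ag W) = inj₂ refl
quiet-or-other W (ag B) = inj₂ refl
quiet-or-other W (ag W) = inj₁ (inj₂ refl)

Indist-refl : ∀ a {n} (t : Act n) → Indist a t t
Indist-refl a {zero}  (ε , X) = refl
Indist-refl a {suc n} (α ▸ p , X) with quiet-or-other a p
... | inj₁ quiet = inj₂ (quiet , quiet , refl , refl)
... | inj₂ refl  = inj₁ (refl , refl , Indist-refl a (α , X))

Indist⇒same-input : ∀ a {n} (s t : Act n) → Indist a s t → proj₂ s at a ≡ proj₂ t at a
Indist⇒same-input a {zero}  (ε , X)     (ε , Y)     X∼Y = X∼Y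
Indist⇒same-input a {suc n} (α ▸ p , X) (β ▸ q , Y) (inj₁ (_ , _ , s∼t)) =
  Indist⇒same-input a (α , X) (β , Y) s∼t
Indist⇒same-input a {suc n} (α ▸ p , X) (β ▸ q , Y) (inj₂ (_ , _ , refl , _)) = refl

-- What a solving morphism amounts to: in the facet of action t, agent a outputs decide a t.
record Solution (n : ℕ) : Set where
  field
    decide   : Ag → Act n → Dec01
    respects : ∀ a s t → Indist a s t → decide a s ≡ decide a t
    valid    : ∀ t → Valid (proj₂ t at B) (proj₂ t at W) (decide B t) (decide W t)
open Solution

peel : ∀ {n} → Solution (suc n) → Solution n
peel {n} S = record { decide = decide′ ; respects = respects′ ; valid = valid′ }
  where
  decide′ : Ag → Act n → Dec01
  decide′ a (α , X) = decide S a (α ▸ ag (other a) , X)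

  respects′ : ∀ a s t → Indist a s t → decide′ a s ≡ decide′ a t
  respects′ a (α , X) (β , Y) s∼t =
    respects S a (α ▸ ag (other a) , X) (β ▸ ag (other a) , Y) (inj₁ (refl , refl , s∼t))

  valid′ : ∀ t → Valid (proj₂ t at B) (proj₂ t at W) (decide′ B t) (decide′ W t)
  valid′ (α , X) =
    valid-zigzag (valid S (α ▸ ag W , X))
                 (respects S W (α ▸ ag W , X) (α ▸ ⊥ₗ , X) (inj₂ (inj₂ refl , inj₁ refl , refl , refl)))
                 (valid S (α ▸ ⊥ₗ , X))
                 (respects S B (α ▸ ⊥ₗ , X) (α ▸ ag B , X) (inj₂ (inj₁ refl , inj₂ refl , refl , refl)))
                 (valid S (α ▸ ag B , X))

lower : ∀ n → Solution n → Solution 0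
lower zero    S = S
lower (suc n) S = lower n (peel S)

no-solution-without-rounds : ¬ Solution 0
no-solution-without-rounds S = proj₁ (valid S (ε , ⟨ 0F , 0F ⟩)) refl agreeing
  where
  d : Ag → Input → Input → Dec01
  d a i j = decide S a (ε , ⟨ i , j ⟩)

  agree : ∀ {i j} → i ≢ j → d B i j ≡ d W i j
  agree {i} {j} i≢j = valid-distinct i≢j (valid S (ε , ⟨ i , j ⟩))

  open ≡-Reasoning
  agreeing : d B 0F 0F ≡ d W 0F 0F
  agreeing = begin
    d B 0F 0F ≡⟨ respects S B _ _ refl ⟩
    d B 0F 2F ≡⟨ agree (λ ()) ⟩
    d W 0F 2F ≡⟨ respects S W _ _ refl ⟩
    d W 1F 2F ≡⟨ agree (λ ()) ⟨
    d B 1F 2F ≡⟨ respects S B _ _ refl ⟩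
    d B 1F 0F ≡⟨ agree (λ ()) ⟩
    d W 1F 0F ≡⟨ respects S W _ _ refl ⟩
    d W 0F 0F ∎

vertexAt : ∀ {n} → Ag → Act n → PVertex n
vertexAt a t = record
  { colour = a ; input = proj₂ t at a ; act = t
  ; live   = t , Indist-refl a t , proj₂ t , refl , λ _ → refl }

decision : OVertex → Dec01
decision (_ , _ , d) = d

∈O-valid : ∀ {i j} (G : OFacet) (u v : OVertex) → πO u ≡ (B , i) → πO v ≡ (W , j) →
  u ∈O G → v ∈O G → Valid i j (decision u) (decision v)
∈O-valid record { valid = valid } (B , _ , _) (W , _ , _) refl refl
  (inj₁ (_ , refl , refl)) (inj₂ (_ , refl , refl)) = valid
∈O-valid G (B , _ , _) _ refl _ (inj₂ (() , _)) _
∈O-valid G _ (W , _ , _) _ refl _ (inj₁ (() , _))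

morphism⇒solution : ∀ {N} (δ : PVertex N → OVertex) → IsMorphism δ →
  (∀ v → πO (δ v) ≡ πP v) → Solution N
morphism⇒solution {N} δ δ-morphism πδ≡π =
  record { decide = decide′ ; respects = respects′ ; valid = valid′ }
  where
  open IsMorphism δ-morphism

  decide′ : Ag → Act N → Dec01
  decide′ a t = decision (δ (vertexAt a t))

  respects′ : ∀ a s t → Indist a s t → decide′ a s ≡ decide′ a t
  respects′ a s t s∼t =
    cong decision
      (wellDefined (vertexAt a s) (vertexAt a t) (refl , Indist⇒same-input a s t s∼t , s∼t))

  valid′ : ∀ t → Valid (proj₂ t at B) (proj₂ t at W) (decide′ B t) (decide′ W t)
  valid′ t with simplices (vertexAt B t ∷ vertexAt W t ∷ [])
                  (proj₂ t , t , (λ _ → refl) , (refl , Indist-refl B t) ∷ (refl , Indist-refl W t) ∷ [])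
  ... | G , uB∈G ∷ uW∈G ∷ [] =
    ∈O-valid G _ _ (πδ≡π (vertexAt B t)) (πδ≡π (vertexAt W t)) uB∈G uW∈G

theorem2 : (N : ℕ) →
    ¬ (Σ (PVertex N → OVertex) λ δ → IsMorphism δ × ((v : PVertex N) → πO (δ v) ≡ πP v))
theorem2 N (δ , δ-morphism , πδ≡π) =
  no-solution-without-rounds (lower N (morphism⇒solution δ δ-morphism πδ≡π))
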